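{- Suppose $(\mathcal G,z)$ is a $\psi$-critical canvas for a tip preflow $\psi$. If $|V(\mathcal G)|\ge 4$, then $\mathcal G-z$ is 2-connected.
   Context: Graphs are finite, loopless, may have parallel edges. A $\mathbb{Z}_3$-boundary of $G$ is $\beta:V(G)\to\mathbb{Z}_3$ summing to $0$ over every component; $\mathcal G=(G,\beta)$ is a $\mathbb{Z}_3$-bordered graph. A nowhere-zero flow is an orientation with $\deg^+(v)-\deg^-(v)\equiv\beta(v)\pmod 3$ for every $v$. For a partition $\mathcal P$ of $V(G)$, $\mathcal G/\mathcal P$ identifies each part into one vertex, deletes loops and sums $\beta$ over parts; $\mathcal P$ is non-trivial if some part has $\ge2$ vertices. A canvas $(\mathcal G,z)$ is a $\mathbb{Z}_3$-bordered graph with tip $z$. A tip preflow is an orientation $\psi$ of the edges at $z$ with (in $\psi$) $\deg^+(z)-\deg^-(z)\equiv\beta(z)\pmod 3$; it extends if some nowhere-zero flow agrees with it at $z$. $\mathcal P$ is tip-respecting if $\{z\}$ is a part. The canvas is $\psi$-critical if $\psi$ does not extend to a nowhere-zero flow in $\mathcal G$ but extends to one in $\mathcal G/\mathcal P$ for every non-trivial tip-respecting partition $\mathcal P$. -}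

module Defs where

open import Data.Nat using (ℕ; zero; suc; _≤_)
open import Data.Fin using (Fin; zero; suc; _≟_)
open import Data.Integer using (ℤ; +_; _+_; _-_)
open import Data.Integer.Divisibility using (_∣_)
open import Data.Bool using (Bool; true; false; if_then_else_)
open import Data.Product using (Σ; ∃; _×_; _,_)
open import Data.Sum using (_⊎_)
open import Data.Unit using (⊤)
open import Relation.Nullary using (¬_)
open import Relation.Nullary.Decidable using (⌊_⌋)
open import Relation.Binary.PropositionalEquality using (_≡_; _≢_)

Σℤ : (k : ℕ) → (Fin k → ℤ) → ℤ
Σℤ zero    f = + 0
Σℤ (suc k) f = f zero + Σℤ k (λ i → f (suc i))

-- Congruence modulo 3 (Z_3 values are represented by integers mod 3).
infix 4 _≡₃_
_≡₃_ : ℤ → ℤ → Set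
a ≡₃ b = (+ 3) ∣ (a - b)

-- A finite loopless multigraph: vertices Fin n, edges Fin m, each edge e
-- has endpoints tl e and hd e (a fixed reference direction).
record Graph : Set where
  field
    n        : ℕ
    m        : ℕ
    tl       : Fin m → Fin n
    hd       : Fin m → Fin n
    loopless : ∀ e → tl e ≢ hd e
open Graph public

Joins : (G : Graph) → Fin (m G) → Fin (n G) → Fin (n G) → Set
Joins G e u w = (tl G e ≡ u × hd G e ≡ w) ⊎ (tl G e ≡ w × hd G e ≡ u)

Incident : (G : Graph) → Fin (m G) → Fin (n G) → Set
Incident G e v = tl G e ≡ v ⊎ hd G e ≡ v

-- Walks inside the induced subgraph on the vertex set A
-- (all vertices after the first must lie in A).
data Reach (G : Graph) (A : Fin (n G) → Set) : Fin (n G) → Fin (n G) → Set where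
  here : ∀ {u} → Reach G A u u
  step : ∀ {u w v} (e : Fin (m G)) → Joins G e u w → A w → Reach G A w v → Reach G A u v

ConnectedOn : (G : Graph) → (Fin (n G) → Set) → Set
ConnectedOn G A = ∀ u v → A u → A v → Reach G A u v

TwoConnectedOn : (G : Graph) → (Fin (n G) → Set) → Set
TwoConnectedOn G A =
  (Σ (Fin (n G)) λ a → Σ (Fin (n G)) λ b → Σ (Fin (n G)) λ c →
     A a × A b × A c × a ≢ b × a ≢ c × b ≢ c)
  × ConnectedOn G A
  × (∀ w → A w → ConnectedOn G (λ x → A x × x ≢ w))

-- Z_3-boundary: beta sums to 0 (mod 3) over every connected component.
-- S is the indicator of the component containing v.
IsBoundary : (G : Graph) → (Fin (n G) → ℤ) → Set
IsBoundary G β =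
  ∀ (v : Fin (n G)) (S : Fin (n G) → Bool) →
    (∀ u → (S u ≡ true → Reach G (λ _ → ⊤) v u) × (Reach G (λ _ → ⊤) v u → S u ≡ true)) →
    Σℤ (n G) (λ u → if S u then β u else + 0) ≡₃ + 0

δ : ∀ {k} → Fin k → Fin k → ℤ
δ x y = if ⌊ x ≟ y ⌋ then + 1 else + 0

-- Net outflow deg⁺(x) - deg⁻(x) at vertex x of the multigraph with edge
-- endpoints t, h (over Fin k) under orientation o (true: t e → h e).
-- A loop contributes 0, so loops are effectively deleted.
netOut : ∀ {k m'} → (Fin m' → Fin k) → (Fin m' → Fin k) → (Fin m' → Bool) → Fin k → ℤ
netOut {m' = m'} t h o x =
  Σℤ m' (λ e → if o e then δ (t e) x - δ (h e) x else δ (h e) x - δ (t e) x)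

-- Partitions of V(G) into k non-empty parts, given by a surjection p.
IsPartition : ∀ {n' k} → (Fin n' → Fin k) → Set
IsPartition {k = k} p = ∀ (i : Fin k) → ∃ λ v → p v ≡ i

-- The contracted bordered graph G/P: vertex set Fin k, edge e joins
-- p (tl e) and p (hd e) (loops contribute nothing to flows), boundary
-- summed over parts.
QuotFlow : (G : Graph) (β : Fin (n G) → ℤ) {k : ℕ} (p : Fin (n G) → Fin k) →
           (Fin (m G) → Bool) → Set
QuotFlow G β {k} p o =
  ∀ (i : Fin k) →
    netOut (λ e → p (tl G e)) (λ e → p (hd G e)) o i
      ≡₃ Σℤ (n G) (λ v → if ⌊ p v ≟ i ⌋ then β v else + 0)

IsNZFlow : (G : Graph) (β : Fin (n G) → ℤ) → (Fin (m G) → Bool) → Set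
IsNZFlow G β o = ∀ x → netOut (tl G) (hd G) o x ≡₃ β x

-- Tip preflow ψ at z: only the values of ψ on edges incident with z matter.
IsTipPreflow : (G : Graph) (β : Fin (n G) → ℤ) (z : Fin (n G)) → (Fin (m G) → Bool) → Set
IsTipPreflow G β z ψ = netOut (tl G) (hd G) ψ z ≡₃ β z

AgreesAt : (G : Graph) (z : Fin (n G)) → (Fin (m G) → Bool) → (Fin (m G) → Bool) → Set
AgreesAt G z ψ o = ∀ e → Incident G e z → o e ≡ ψ e

Extends : (G : Graph) (β : Fin (n G) → ℤ) (z : Fin (n G)) → (Fin (m G) → Bool) → Set
Extends G β z ψ = ∃ λ o → IsNZFlow G β o × AgreesAt G z ψ o

ExtendsQuot : (G : Graph) (β : Fin (n G) → ℤ) (z : Fin (n G)) → (Fin (m G) → Bool) →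
              {k : ℕ} → (Fin (n G) → Fin k) → Set
ExtendsQuot G β z ψ p = ∃ λ o → QuotFlow G β p o × AgreesAt G z ψ o

NonTrivial : ∀ {n' k} → (Fin n' → Fin k) → Set
NonTrivial {n'} p = Σ (Fin n') λ u → Σ (Fin n') λ v → u ≢ v × p u ≡ p v

TipRespecting : ∀ {n' k} → (Fin n' → Fin k) → Fin n' → Set
TipRespecting p z = ∀ v → p v ≡ p z → v ≡ z

IsCritical : (G : Graph) (β : Fin (n G) → ℤ) (z : Fin (n G)) → (Fin (m G) → Bool) → Set
IsCritical G β z ψ =
  ¬ Extends G β z ψ
  × (∀ (k : ℕ) (p : Fin (n G) → Fin k) → IsPartition p → NonTrivial p →
       TipRespecting p z → ExtendsQuot G β z ψ p)

{-# OPTIONS --safe #-}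
-- Suppose w ≠ z and u, v are vertices of G − {z, w} not joined by a path in it; let X be the
-- set of vertices reachable from u there and Y ∋ v the other vertices of G − {z, w}.
-- Contracting Y ∪ {w}, and separately X ∪ {w}, gives non-trivial tip-respecting partitions, so
-- ψ extends to flows o₁ and o₂ of the two contractions. No edge joins X to Y, so orienting the
-- edges touching X as in o₁ and all others as in o₂ satisfies the boundary condition at z and at
-- every vertex of X and of Y, each being a singleton part of the contraction whose orientation
-- is used around it. It then holds at w too, because net outflows sum to 0 and, by the flow on
-- either contraction, so does β modulo 3. Hence ψ extends to G, contradicting criticality.
-- Connectivity of G − z itself follows by avoiding a fourth vertex.
module Submission where

open import Defs
open import Data.Nat using (ℕ; zero; suc; _≤_; _<_)
open import Data.Integer using (ℤ; +_; _+_; _-_; -_)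
import Data.Integer.Properties as ℤ
open import Data.Integer.Tactic.RingSolver using (solve-∀)
open import Data.Integer.Divisibility.Signed using (_∣_; divides; ∣ᵤ⇒∣; ∣⇒∣ᵤ; ∣m⇒∣-m; ∣m∣n⇒∣m+n; ∣m+n∣n⇒∣m; ∣m+n∣m⇒∣n)
open import Data.Bool using (Bool; true; false; if_then_else_)
open import Data.Fin using (Fin; zero; suc; _≟_)
open import Data.Fin.Properties using (suc-injective; any?; ¬∀⟶∃¬; pigeonhole; <⇒≢)
open import Data.Fin.Subset using (Subset; ⊤; _∈_; _⊂_) renaming (_-_ to _∖_)
open import Data.Fin.Subset.Properties using (_∈?_; ∈⊤; p─q⊆p; x∈p∧x≢y⇒x∈p-y; x∈p⇒p-x⊂p)
open import Data.Fin.Subset.Induction using (⊂-wellFounded)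
open import Induction.WellFounded using (Acc; acc)
open import Data.Product using (Σ; ∃; _×_; _,_; proj₁; proj₂)
open import Data.Sum using (_⊎_; inj₁; inj₂; [_,_]′) renaming (map to ⊎-map)
open import Data.Empty using (⊥-elim)
open import Function using (_∘_; id; _⇔_; mk⇔; Equivalence)
open import Function.Definitions using (Injective)
open import Relation.Nullary using (¬_; Dec; yes; no)
open import Relation.Nullary.Decidable using (⌊_⌋; ⌊⌋-map′; isYes≗does; does-⇔; map′; ¬?; _×-dec_; _⊎-dec_; decidable-stable)
open import Relation.Unary using (Decidable)
open import Relation.Binary.PropositionalEquality

Σℤ-cong : ∀ k {f g : Fin k → ℤ} → (∀ i → f i ≡ g i) → Σℤ k f ≡ Σℤ k g
Σℤ-cong zero    f≗g = refl
Σℤ-cong (suc k) f≗g = cong₂ _+_ (f≗g zero) (Σℤ-cong k (f≗g ∘ suc))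

Σℤ-zero : ∀ k {f : Fin k → ℤ} → (∀ i → f i ≡ + 0) → Σℤ k f ≡ + 0
Σℤ-zero zero    f≗0 = refl
Σℤ-zero (suc k) f≗0 = cong₂ _+_ (f≗0 zero) (Σℤ-zero k (f≗0 ∘ suc))

Σℤ-distrib-+ : ∀ k (f g : Fin k → ℤ) → Σℤ k (λ i → f i + g i) ≡ Σℤ k f + Σℤ k g
Σℤ-distrib-+ zero    f g = refl
Σℤ-distrib-+ (suc k) f g = trans
  (cong (_+_ (f zero + g zero)) (Σℤ-distrib-+ k (f ∘ suc) (g ∘ suc)))
  (interchange (f zero) (g zero) (Σℤ k (f ∘ suc)) (Σℤ k (g ∘ suc)))
  where
  interchange : ∀ a b c d → (a + b) + (c + d) ≡ (a + c) + (b + d)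
  interchange = solve-∀

Σℤ-distrib-minus : ∀ k (f g : Fin k → ℤ) → Σℤ k (λ i → f i - g i) ≡ Σℤ k f - Σℤ k g
Σℤ-distrib-minus zero    f g = refl
Σℤ-distrib-minus (suc k) f g = trans
  (cong (_+_ (f zero - g zero)) (Σℤ-distrib-minus k (f ∘ suc) (g ∘ suc)))
  (interchange (f zero) (g zero) (Σℤ k (f ∘ suc)) (Σℤ k (g ∘ suc)))
  where
  interchange : ∀ a b c d → (a - b) + (c - d) ≡ (a + c) - (b + d)
  interchange = solve-∀

Σℤ-comm : ∀ a b (f : Fin a → Fin b → ℤ) →
  Σℤ a (λ i → Σℤ b (f i)) ≡ Σℤ b (λ j → Σℤ a (λ i → f i j))
Σℤ-comm zero    b f = sym (Σℤ-zero b λ _ → refl)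
Σℤ-comm (suc a) b f = trans
  (cong (_+_ (Σℤ b (f zero))) (Σℤ-comm a b (f ∘ suc)))
  (sym (Σℤ-distrib-+ b (f zero) (λ j → Σℤ a (λ i → f (suc i) j))))

Σℤ-indicator : ∀ k (a : Fin k) (x : ℤ) → Σℤ k (λ i → if ⌊ a ≟ i ⌋ then x else + 0) ≡ x
Σℤ-indicator (suc k) zero    x = trans (cong (_+_ x) (Σℤ-zero k λ _ → refl)) (ℤ.+-identityʳ x)
Σℤ-indicator (suc k) (suc a) x = trans (ℤ.+-identityˡ _) (trans
  (Σℤ-cong k λ i → cong (if_then x else + 0) (⌊⌋-map′ (cong suc) suc-injective (a ≟ i)))
  (Σℤ-indicator k a x))

module _ {d : ℤ} where

  ∣-Σℤ : ∀ k {f : Fin k → ℤ} → (∀ i → d ∣ f i) → d ∣ Σℤ k f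
  ∣-Σℤ zero    d∣f = divides (+ 0) refl
  ∣-Σℤ (suc k) d∣f = ∣m∣n⇒∣m+n (d∣f zero) (∣-Σℤ k (d∣f ∘ suc))

  ∣-Σℤ-except : ∀ k {f : Fin k → ℤ} (c : Fin k) → d ∣ Σℤ k f → (∀ i → i ≢ c → d ∣ f i) → d ∣ f c
  ∣-Σℤ-except (suc k) zero    d∣Σ d∣f = ∣m+n∣n⇒∣m d∣Σ (∣-Σℤ k λ i → d∣f (suc i) λ ())
  ∣-Σℤ-except (suc k) (suc c) d∣Σ d∣f =
    ∣-Σℤ-except k c (∣m+n∣m⇒∣n d∣Σ (d∣f zero λ ())) λ i i≢c → d∣f (suc i) (i≢c ∘ suc-injective)

⌊⌋-cong : ∀ {A B : Set} → A ⇔ B → (a? : Dec A) (b? : Dec B) → ⌊ a? ⌋ ≡ ⌊ b? ⌋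
⌊⌋-cong A⇔B a? b? = trans (isYes≗does a?) (trans (does-⇔ A⇔B a? b?) (sym (isYes≗does b?)))

δ-cong : ∀ {k k′} {a b : Fin k} {c d : Fin k′} → (a ≡ b ⇔ c ≡ d) → δ a b ≡ δ c d
δ-cong {a = a} {b} {c} {d} a≡b⇔c≡d = cong (if_then + 1 else + 0) (⌊⌋-cong a≡b⇔c≡d (a ≟ b) (c ≟ d))

δ-≢ : ∀ {k} {a b : Fin k} → a ≢ b → δ a b ≡ + 0
δ-≢ {a = a} {b} a≢b with a ≟ b
... | yes a≡b = ⊥-elim (a≢b a≡b)
... | no _    = refl

-- netOut t h o x unfolds to Σℤ m′ (λ e → contribution (o e) (δ (t e) x) (δ (h e) x)).
contribution : Bool → ℤ → ℤ → ℤ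
contribution b p q = if b then p - q else q - p

contribution-nonincident : ∀ b {k} {a a′ x : Fin k} → a ≢ x → a′ ≢ x → contribution b (δ a x) (δ a′ x) ≡ + 0
contribution-nonincident b a≢x a′≢x rewrite δ-≢ a≢x | δ-≢ a′≢x with b
... | true  = refl
... | false = refl

module _ {k m′ : ℕ} (t h : Fin m′ → Fin k) where

  netOut-local : ∀ {o o′ : Fin m′ → Bool} x → (∀ e → t e ≡ x ⊎ h e ≡ x → o e ≡ o′ e) →
                 netOut t h o x ≡ netOut t h o′ x
  netOut-local {o} {o′} x o≈o′ = Σℤ-cong m′ edge
    where
    edge : ∀ e → contribution (o e) (δ (t e) x) (δ (h e) x) ≡ contribution (o′ e) (δ (t e) x) (δ (h e) x)
    edge e with (t e ≟ x) ⊎-dec (h e ≟ x)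
    ... | yes incident = cong (λ b → contribution b (δ (t e) x) (δ (h e) x)) (o≈o′ e incident)
    ... | no ¬incident = trans (contribution-nonincident (o e) (¬incident ∘ inj₁) (¬incident ∘ inj₂))
                               (sym (contribution-nonincident (o′ e) (¬incident ∘ inj₁) (¬incident ∘ inj₂)))

  netOut-isolated : ∀ o x → (∀ e → t e ≢ x) → (∀ e → h e ≢ x) → netOut t h o x ≡ + 0
  netOut-isolated o x t≢x h≢x = Σℤ-zero m′ λ e → contribution-nonincident (o e) (t≢x e) (h≢x e)

  netOut-handshake : ∀ o → Σℤ k (netOut t h o) ≡ + 0
  netOut-handshake o = trans (Σℤ-comm k m′ _) (Σℤ-zero m′ edge)
    where
    cancel : ∀ a a′ → Σℤ k (λ x → δ a x - δ a′ x) ≡ + 0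
    cancel a a′ = trans (Σℤ-distrib-minus k (δ a) (δ a′))
                        (cong₂ _-_ (Σℤ-indicator k a (+ 1)) (Σℤ-indicator k a′ (+ 1)))
    edge : ∀ e → Σℤ k (λ x → contribution (o e) (δ (t e) x) (δ (h e) x)) ≡ + 0
    edge e with o e
    ... | true  = cancel (t e) (h e)
    ... | false = cancel (h e) (t e)

  netOut-relabel : ∀ {k₁ k₂} (f : Fin k → Fin k₁) (g : Fin k → Fin k₂) o {y₁ y₂} →
                   (∀ a → f a ≡ y₁ ⇔ g a ≡ y₂) →
                   netOut (f ∘ t) (f ∘ h) o y₁ ≡ netOut (g ∘ t) (g ∘ h) o y₂
  netOut-relabel f g o fibres = Σℤ-cong m′ λ e →
    cong₂ (contribution (o e)) (δ-cong (fibres (t e))) (δ-cong (fibres (h e)))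

  netOut-defect : ∀ o (b : Fin k → ℤ) → Σℤ k (λ x → netOut t h o x - b x) ≡ - Σℤ k b
  netOut-defect o b = begin
    Σℤ k (λ x → netOut t h o x - b x)  ≡⟨ Σℤ-distrib-minus k (netOut t h o) b ⟩
    Σℤ k (netOut t h o) - Σℤ k b       ≡⟨ cong (_- Σℤ k b) (netOut-handshake o) ⟩
    + 0 - Σℤ k b                       ≡⟨ ℤ.+-identityˡ (- Σℤ k b) ⟩
    - Σℤ k b                           ∎
    where open ≡-Reasoning

  flow⇒3∣Σ : ∀ o (b : Fin k → ℤ) → (∀ x → netOut t h o x ≡₃ b x) → + 3 ∣ Σℤ k b
  flow⇒3∣Σ o b flow = subst (+ 3 ∣_) (ℤ.neg-involutive (Σℤ k b))
    (∣m⇒∣-m (subst (+ 3 ∣_) (netOut-defect o b) (∣-Σℤ k (∣ᵤ⇒∣ ∘ flow))))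

  flow-at-remaining-vertex : ∀ o (b : Fin k → ℤ) c → (∀ x → x ≢ c → netOut t h o x ≡₃ b x) →
                 + 3 ∣ Σℤ k b → netOut t h o c ≡₃ b c
  flow-at-remaining-vertex o b c flow 3∣Σb = ∣⇒∣ᵤ (∣-Σℤ-except k c
    (subst (+ 3 ∣_) (sym (netOut-defect o b)) (∣m⇒∣-m 3∣Σb))
    (λ x x≢c → ∣ᵤ⇒∣ (flow x x≢c)))

fibreSum : ∀ {N k} → (Fin N → Fin k) → (Fin N → ℤ) → Fin k → ℤ
fibreSum {N} p β i = Σℤ N (λ v → if ⌊ p v ≟ i ⌋ then β v else + 0)

module _ {N : ℕ} (β : Fin N → ℤ) where

  fibreSum-relabel : ∀ {k₁ k₂} (f : Fin N → Fin k₁) (g : Fin N → Fin k₂) {y₁ y₂} →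
                     (∀ a → f a ≡ y₁ ⇔ g a ≡ y₂) → fibreSum f β y₁ ≡ fibreSum g β y₂
  fibreSum-relabel f g {y₁} {y₂} fibres = Σℤ-cong N λ v →
    cong (if_then β v else + 0) (⌊⌋-cong (fibres v) (f v ≟ y₁) (g v ≟ y₂))

  fibreSum-empty : ∀ {k} (f : Fin N → Fin k) {y} → (∀ a → f a ≢ y) → fibreSum f β y ≡ + 0
  fibreSum-empty f {y} f≢y = Σℤ-zero N pointwise
    where
    pointwise : ∀ v → (if ⌊ f v ≟ y ⌋ then β v else + 0) ≡ + 0
    pointwise v with f v ≟ y
    ... | yes fv≡y = ⊥-elim (f≢y v fv≡y)
    ... | no _     = refl

  fibreSum-singleton : ∀ {k} (f : Fin N → Fin k) {y x} → (∀ a → f a ≡ y ⇔ a ≡ x) → fibreSum f β y ≡ β x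
  fibreSum-singleton f {y} {x} fibre = trans (Σℤ-cong N pointwise) (Σℤ-indicator N x (β x))
    where
    pointwise : ∀ v → (if ⌊ f v ≟ y ⌋ then β v else + 0) ≡ (if ⌊ x ≟ v ⌋ then β x else + 0)
    pointwise v with x ≟ v | f v ≟ y
    ... | yes refl | yes _    = refl
    ... | yes refl | no fx≢y  = ⊥-elim (fx≢y (Equivalence.from (fibre x) refl))
    ... | no x≢v   | yes fv≡y = ⊥-elim (x≢v (sym (Equivalence.to (fibre v) fv≡y)))
    ... | no _     | no _     = refl

  Σℤ-fibreSum : ∀ {k} (p : Fin N → Fin k) → Σℤ k (fibreSum p β) ≡ Σℤ N β
  Σℤ-fibreSum {k} p = trans (Σℤ-comm k N _) (Σℤ-cong N λ v → Σℤ-indicator k (p v) (β v))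

module _ (G : Graph) {β : Fin (n G) → ℤ} where

  quotFlow⇒3∣Σβ : ∀ {k} {p : Fin (n G) → Fin k} {o} → QuotFlow G β p o → + 3 ∣ Σℤ (n G) β
  quotFlow⇒3∣Σβ {p = p} {o} flow =
    subst (+ 3 ∣_) (Σℤ-fibreSum β p) (flow⇒3∣Σ (p ∘ tl G) (p ∘ hd G) o (fibreSum p β) flow)

  quotFlow-singleton : ∀ {k} {p : Fin (n G) → Fin k} {o o′} {y v} → QuotFlow G β p o′ →
                       (∀ a → p a ≡ y ⇔ a ≡ v) → (∀ e → Incident G e v → o e ≡ o′ e) →
                       netOut (tl G) (hd G) o v ≡₃ β v
  quotFlow-singleton {p = p} {o} {o′} {y} {v} flow fibre o≈o′ = subst₂ _≡₃_
    (trans (netOut-relabel (tl G) (hd G) p id o′ fibre) (sym (netOut-local (tl G) (hd G) v o≈o′)))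
    (fibreSum-singleton β p fibre)
    (flow y)

record ImageFactorisation {a b : ℕ} (f : Fin a → Fin b) : Set where
  field
    size            : ℕ
    onto            : Fin a → Fin size
    into            : Fin size → Fin b
    onto-surjective : IsPartition onto
    into-injective  : Injective _≡_ _≡_ into
    factorises      : ∀ x → into (onto x) ≡ f x

  fibre : ∀ j x → onto x ≡ j ⇔ f x ≡ into j
  fibre j x = mk⇔ (λ { refl → sym (factorises x) }) (λ fx≡ → into-injective (trans (factorises x) fx≡))

  onto-reflects : ∀ {x y} → onto x ≡ onto y → f x ≡ f y
  onto-reflects {x} {y} eq = trans (sym (factorises x)) (trans (cong into eq) (factorises y))

  onto-preserves : ∀ {x y} → f x ≡ f y → onto x ≡ onto y
  onto-preserves {x} {y} eq = into-injective (trans (factorises x) (trans eq (sym (factorises y))))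

imageFactorisation : ∀ {a b} (f : Fin a → Fin b) → ImageFactorisation f
imageFactorisation {zero} f = record
  { size = 0 ; onto = λ () ; into = λ () ; onto-surjective = λ () ; into-injective = λ {} ; factorises = λ () }
imageFactorisation {suc a} f = extend (imageFactorisation (f ∘ suc))
  where
  extend : ImageFactorisation (f ∘ suc) → ImageFactorisation f
  extend F with any? (λ j → ImageFactorisation.into F j ≟ f zero)
  ... | yes (j , into-j≡f0) = record
    { size = size ; onto = onto′ ; into = into ; into-injective = into-injective
    ; onto-surjective = λ i → let (x , eq) = onto-surjective i in suc x , eq
    ; factorises = λ { zero → into-j≡f0 ; (suc x) → factorises x } }
    where
    open ImageFactorisation F
    onto′ : Fin (suc a) → Fin size
    onto′ zero    = j
    onto′ (suc x) = onto x
  ... | no f0∉image = record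
    { size = suc size ; onto = onto′ ; into = into′ ; into-injective = into′-injective
    ; onto-surjective = λ { zero → zero , refl ; (suc i) → let (x , eq) = onto-surjective i in suc x , cong suc eq }
    ; factorises = λ { zero → refl ; (suc x) → factorises x } }
    where
    open ImageFactorisation F
    onto′ : Fin (suc a) → Fin (suc size)
    onto′ zero    = zero
    onto′ (suc x) = suc (onto x)
    into′ : Fin (suc size) → Fin _
    into′ zero    = f zero
    into′ (suc j) = into j
    into′-injective : Injective _≡_ _≡_ into′
    into′-injective {zero}  {zero}  _  = refl
    into′-injective {zero}  {suc j} eq = ⊥-elim (f0∉image (j , sym eq))
    into′-injective {suc i} {zero}  eq = ⊥-elim (f0∉image (i , eq))
    into′-injective {suc i} {suc j} eq = cong suc (into-injective eq)

module _ (G : Graph) {β : Fin (n G) → ℤ} {z : Fin (n G)} {ψ : Fin (m G) → Bool} where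

  extendsQuot-image : ∀ {k} {q : Fin (n G) → Fin k} (F : ImageFactorisation q) →
                      ExtendsQuot G β z ψ (ImageFactorisation.onto F) → ExtendsQuot G β z ψ q
  extendsQuot-image {q = q} F (o , flow , agrees) = o , flow′ , agrees
    where
    open ImageFactorisation F
    flow′ : QuotFlow G β q o
    flow′ i with any? (λ j → into j ≟ i)
    ... | yes (j , refl) = subst₂ _≡₃_
      (netOut-relabel (tl G) (hd G) onto q o (fibre j))
      (fibreSum-relabel β onto q (fibre j))
      (flow j)
    ... | no i∉image = subst₂ _≡₃_
      (sym (netOut-isolated (q ∘ tl G) (q ∘ hd G) o i (outside ∘ tl G) (outside ∘ hd G)))
      (sym (fibreSum-empty β q outside))
      (∣⇒∣ᵤ {k = + 3} (divides (+ 0) refl))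
      where
      outside : ∀ x → q x ≢ i
      outside x qx≡i = i∉image (onto x , trans (factorises x) qx≡i)

  -- q need not be onto: criticality is applied to the partition onto its image.
  critical⇒extendsQuot : IsCritical G β z ψ → ∀ {k} (q : Fin (n G) → Fin k) →
                         NonTrivial q → TipRespecting q z → ExtendsQuot G β z ψ q
  critical⇒extendsQuot (_ , extends) q (u , v , u≢v , qu≡qv) respects =
    extendsQuot-image F (extends size onto onto-surjective
      (u , v , u≢v , onto-preserves qu≡qv) (λ w → respects w ∘ onto-reflects))
    where
    F : ImageFactorisation q
    F = imageFactorisation q
    open ImageFactorisation F

module _ {N : ℕ} {S : Fin N → Set} (S? : Decidable S) where

  collapse : Fin N → Fin N → Fin N
  collapse c v with S? v
  ... | yes _ = c
  ... | no _  = v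

  collapse-fibre : ∀ {c v} → ¬ S v → v ≢ c → ∀ u → collapse c u ≡ v ⇔ u ≡ v
  collapse-fibre {c} {v} v∉S v≢c u = mk⇔ to from
    where
    to : collapse c u ≡ v → u ≡ v
    to with S? u
    ... | yes _ = ⊥-elim ∘ v≢c ∘ sym
    ... | no _  = id
    from : u ≡ v → collapse c u ≡ v
    from refl with S? u
    ... | yes u∈S = ⊥-elim (v∉S u∈S)
    ... | no _    = refl

  collapse-nonTrivial : ∀ {c s} → S s → s ≢ c → NonTrivial (collapse c)
  collapse-nonTrivial {c} {s} s∈S s≢c = s , c , s≢c , trans (collapse-S s∈S) (sym collapse-c)
    where
    collapse-S : ∀ {u} → S u → collapse c u ≡ c
    collapse-S {u} u∈S with S? u
    ... | yes _   = refl
    ... | no u∉S  = ⊥-elim (u∉S u∈S)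
    collapse-c : collapse c c ≡ c
    collapse-c with S? c
    ... | yes _ = refl
    ... | no _  = refl

  collapse-tipRespecting : ∀ {c z} → ¬ S z → z ≢ c → TipRespecting (collapse c) z
  collapse-tipRespecting {c} {z} z∉S z≢c v cv≡cz =
    Equivalence.to (fibre v) (trans cv≡cz (Equivalence.from (fibre z) refl))
    where
    fibre : ∀ u → collapse c u ≡ z ⇔ u ≡ z
    fibre = collapse-fibre z∉S z≢c

module SplicedFlow
  (G : Graph) {β : Fin (n G) → ℤ} {z : Fin (n G)} {ψ : Fin (m G) → Bool}
  (tip : IsTipPreflow G β z ψ) (critical : IsCritical G β z ψ)
  {X : Fin (n G) → Set} (X? : Decidable X) {c : Fin (n G)} (c≢z : c ≢ z) (z∉X : ¬ X z) (c∉X : ¬ X c)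
  (closed : ∀ {e x y} → Joins G e x y → X x → y ≢ z → y ≢ c → X y)
  {x₀ y₀ : Fin (n G)} (x₀∈X : X x₀) (y₀∉X : ¬ X y₀) (y₀≢z : y₀ ≢ z) (y₀≢c : y₀ ≢ c)
  where

  Rest : Fin (n G) → Set
  Rest v = ¬ X v × v ≢ z

  rest? : Decidable Rest
  rest? v = ¬? (X? v) ×-dec ¬? (v ≟ z)

  q₁ q₂ : Fin (n G) → Fin (n G)
  q₁ = collapse rest? c
  q₂ = collapse X? c

  extension₁ : ExtendsQuot G β z ψ q₁
  extension₁ = critical⇒extendsQuot G critical q₁
    (collapse-nonTrivial rest? (y₀∉X , y₀≢z) y₀≢c)
    (collapse-tipRespecting rest? (λ (_ , z≢z) → z≢z refl) (c≢z ∘ sym))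

  extension₂ : ExtendsQuot G β z ψ q₂
  extension₂ = critical⇒extendsQuot G critical q₂
    (collapse-nonTrivial X? x₀∈X (λ x₀≡c → c∉X (subst X x₀≡c x₀∈X)))
    (collapse-tipRespecting X? z∉X (c≢z ∘ sym))

  o₁ o₂ o : Fin (m G) → Bool
  o₁ = proj₁ extension₁
  o₂ = proj₁ extension₂
  o e with X? (tl G e) ⊎-dec X? (hd G e)
  ... | yes _ = o₁ e
  ... | no _  = o₂ e

  agrees : AgreesAt G z ψ o
  agrees e e∋z with X? (tl G e) ⊎-dec X? (hd G e)
  ... | yes _ = proj₂ (proj₂ extension₁) e e∋z
  ... | no _  = proj₂ (proj₂ extension₂) e e∋z

  flow-X : ∀ {v} → X v → netOut (tl G) (hd G) o v ≡₃ β v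
  flow-X {v} v∈X = quotFlow-singleton G (proj₁ (proj₂ extension₁))
    (collapse-fibre rest? (λ (v∉X , _) → v∉X v∈X) (λ v≡c → c∉X (subst X v≡c v∈X))) o≈o₁
    where
    o≈o₁ : ∀ e → Incident G e v → o e ≡ o₁ e
    o≈o₁ e e∋v with X? (tl G e) ⊎-dec X? (hd G e)
    ... | yes _      = refl
    ... | no ¬touchX = ⊥-elim (¬touchX (⊎-map (λ { refl → v∈X }) (λ { refl → v∈X }) e∋v))

  flow-beyond : ∀ {v} → ¬ X v → v ≢ z → v ≢ c → netOut (tl G) (hd G) o v ≡₃ β v
  flow-beyond {v} v∉X v≢z v≢c = quotFlow-singleton G (proj₁ (proj₂ extension₂)) (collapse-fibre X? v∉X v≢c) o≈o₂
    where
    o≈o₂ : ∀ e → Incident G e v → o e ≡ o₂ e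
    o≈o₂ e e∋v with X? (tl G e) ⊎-dec X? (hd G e) | e∋v
    ... | no _         | _        = refl
    ... | yes (inj₁ t∈X) | inj₁ t≡v = ⊥-elim (v∉X (subst X t≡v t∈X))
    ... | yes (inj₁ t∈X) | inj₂ h≡v = ⊥-elim (v∉X (closed (inj₁ (refl , h≡v)) t∈X v≢z v≢c))
    ... | yes (inj₂ h∈X) | inj₁ t≡v = ⊥-elim (v∉X (closed (inj₂ (t≡v , refl)) h∈X v≢z v≢c))
    ... | yes (inj₂ h∈X) | inj₂ h≡v = ⊥-elim (v∉X (subst X h≡v h∈X))

  flow-z : netOut (tl G) (hd G) o z ≡₃ β z
  flow-z = subst (_≡₃ β z) (netOut-local (tl G) (hd G) z (λ e e∋z → sym (agrees e e∋z))) tip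

  flow-off-c : ∀ v → v ≢ c → netOut (tl G) (hd G) o v ≡₃ β v
  flow-off-c v v≢c with v ≟ z | X? v
  ... | yes refl | _       = flow-z
  ... | no v≢z   | yes v∈X = flow-X v∈X
  ... | no v≢z   | no v∉X  = flow-beyond v∉X v≢z v≢c

  flow : IsNZFlow G β o
  flow v with v ≟ c
  ... | yes refl = flow-at-remaining-vertex (tl G) (hd G) o β c flow-off-c (quotFlow⇒3∣Σβ G (proj₁ (proj₂ extension₂)))
  ... | no v≢c   = flow-off-c v v≢c

  extension : Extends G β z ψ
  extension = o , flow , agrees

module _ {G : Graph} where

  Reach-mono : ∀ {A B : Fin (n G) → Set} {u v} → (∀ {x} → A x → B x) → Reach G A u v → Reach G B u v
  Reach-mono A⊆B here            = here
  Reach-mono A⊆B (step e j Aw r) = step e j (A⊆B Aw) (Reach-mono A⊆B r)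

  Reach-snoc : ∀ {A : Fin (n G) → Set} {u w v e} → Reach G A u w → Joins G e w v → A v → Reach G A u v
  Reach-snoc here            j Av = step _ j Av here
  Reach-snoc (step e j Aw r) j′ Av = step e j Aw (Reach-snoc r j′ Av)

  Reach-end : ∀ {A : Fin (n G) → Set} {u v} → Reach G A u v → u ≡ v ⊎ A v
  Reach-end here                 = inj₁ refl
  Reach-end (step e j Aw r)      = inj₂ ([ (λ { refl → Aw }) , id ]′ (Reach-end r))

  Reach-avoid : ∀ {A : Fin (n G) → Set} {x v} → Reach G A x v → ∀ w →
                Reach G (λ y → A y × y ≢ w) x v ⊎ Reach G (λ y → A y × y ≢ w) w v
  Reach-avoid here w = inj₁ here
  Reach-avoid (step {w = y} e j Ay r) w with Reach-avoid r w | y ≟ w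
  ... | inj₂ from-w | _        = inj₂ from-w
  ... | inj₁ from-y | yes refl = inj₂ from-y
  ... | inj₁ from-y | no y≢w   = inj₁ (step e j (Ay , y≢w) from-y)

  joins? : ∀ e u w → Dec (Joins G e u w)
  joins? e u w = ((tl G e ≟ u) ×-dec (hd G e ≟ w)) ⊎-dec ((tl G e ≟ w) ×-dec (hd G e ≟ u))

  reach? : ∀ {A : Fin (n G) → Set} → Decidable A → ∀ u v → Dec (Reach G A u v)
  reach? {A} A? u v = map′ (Reach-mono proj₁) (Reach-mono (_, ∈⊤)) (within ⊤ (⊂-wellFounded ⊤) u)
    where
    Within : Subset (n G) → Fin (n G) → Set
    Within S x = A x × x ∈ S
    -- Recursion on the set S of usable vertices: after the first step, to w, the rest of the walk
    -- can avoid w (Reach-avoid), so w leaves S.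
    within : ∀ S → Acc _⊂_ S → ∀ u → Dec (Reach G (Within S) u v)
    within S (acc smaller) u with u ≟ v
    ... | yes refl = yes here
    ... | no u≢v   = map′ viaFirstStep firstStep (any? λ e → any? λ w → joins? e u w ×-dec next? w)
      where
      FirstStep : Fin (m G) → Fin (n G) → Set
      FirstStep e w = Joins G e u w × Within S w × Reach G (Within (S ∖ w)) w v
      next? : ∀ w → Dec (Within S w × Reach G (Within (S ∖ w)) w v)
      next? w with A? w ×-dec w ∈? S
      ... | no w∉   = no (w∉ ∘ proj₁)
      ... | yes w∈  = map′ (w∈ ,_) proj₂ (within (S ∖ w) (smaller (x∈p⇒p-x⊂p (proj₂ w∈))) w)
      viaFirstStep : (∃ λ e → ∃ (FirstStep e)) → Reach G (Within S) u v
      viaFirstStep (e , w , j , w∈ , r) = step e j w∈ (Reach-mono (λ (Ax , x∈) → Ax , p─q⊆p S _ x∈) r)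
      firstStep : Reach G (Within S) u v → ∃ λ e → ∃ (FirstStep e)
      firstStep here = ⊥-elim (u≢v refl)
      firstStep (step {w = w} e j w∈ r) = e , w , j , w∈ , Reach-mono shrink ([ id , id ]′ (Reach-avoid r w))
        where
        shrink : ∀ {x} → Within S x × x ≢ w → Within (S ∖ w) x
        shrink ((Ax , x∈S) , x≢w) = Ax , x∈p∧x≢y⇒x∈p-y x∈S x≢w

fresh-vertex : ∀ {N} → 3 < N → (a b c : Fin N) → ∃ λ d → d ≢ a × d ≢ b × d ≢ c
fresh-vertex {N} 3<N a b c =
  let d , uncovered = ¬∀⟶∃¬ N _ (λ d → (d ≟ a) ⊎-dec (d ≟ b) ⊎-dec (d ≟ c)) covered⇒⊥
  in  d , uncovered ∘ inj₁ , uncovered ∘ inj₂ ∘ inj₁ , uncovered ∘ inj₂ ∘ inj₂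
  where
  name : Fin 3 → Fin N
  name zero             = a
  name (suc zero)       = b
  name (suc (suc zero)) = c
  label : ∀ {d} → d ≡ a ⊎ d ≡ b ⊎ d ≡ c → ∃ λ i → name i ≡ d
  label (inj₁ refl)        = zero , refl
  label (inj₂ (inj₁ refl)) = suc zero , refl
  label (inj₂ (inj₂ refl)) = suc (suc zero) , refl
  covered⇒⊥ : ¬ (∀ d → d ≡ a ⊎ d ≡ b ⊎ d ≡ c)
  covered⇒⊥ covered with i , j , i<j , same ← pigeonhole 3<N (proj₁ ∘ label ∘ covered) =
    <⇒≢ i<j (trans (sym (proj₂ (label (covered i)))) (trans (cong name same) (proj₂ (label (covered j)))))

three-distinct-avoiding : ∀ {N} → 3 < N → (z : Fin N) →
  Σ (Fin N) λ a → Σ (Fin N) λ b → Σ (Fin N) λ c → a ≢ z × b ≢ z × c ≢ z × a ≢ b × a ≢ c × b ≢ c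
three-distinct-avoiding 3<N z =
  let a , a≢z , _         = fresh-vertex 3<N z z z
      b , b≢z , b≢a , _   = fresh-vertex 3<N z a a
      c , c≢z , c≢a , c≢b = fresh-vertex 3<N z a b
  in  a , b , c , a≢z , b≢z , c≢z , b≢a ∘ sym , c≢a ∘ sym , c≢b ∘ sym

module _ {G : Graph} {β : Fin (n G) → ℤ} {z : Fin (n G)} {ψ : Fin (m G) → Bool}
         (tip : IsTipPreflow G β z ψ) (critical : IsCritical G β z ψ) where

  critical⇒connected-without : ∀ w → w ≢ z → ConnectedOn G (λ x → x ≢ z × x ≢ w)
  critical⇒connected-without w w≢z u v (u≢z , u≢w) (v≢z , v≢w) =
    decidable-stable (reach? allowed? u v) λ ¬reach → proj₁ critical
      (SplicedFlow.extension G tip critical (reach? allowed? u) w≢z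
        (unreachable u≢z λ (z≢z , _) → z≢z refl) (unreachable u≢w λ (_ , w≢w) → w≢w refl)
        (λ j reach-x y≢z y≢w → Reach-snoc reach-x j (y≢z , y≢w)) here ¬reach v≢z v≢w)
    where
    allowed? : Decidable (λ x → x ≢ z × x ≢ w)
    allowed? x = ¬? (x ≟ z) ×-dec ¬? (x ≟ w)
    unreachable : ∀ {y} → u ≢ y → ¬ (y ≢ z × y ≢ w) → ¬ Reach G (λ x → x ≢ z × x ≢ w) u y
    unreachable u≢y y-forbidden = [ u≢y , y-forbidden ]′ ∘ Reach-end

mainTheorem14 : (G : Graph) (β : Fin (n G) → ℤ) (z : Fin (n G)) (ψ : Fin (m G) → Bool) →
    IsBoundary G β → IsTipPreflow G β z ψ → IsCritical G β z ψ → 4 ≤ n G →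
    TwoConnectedOn G (λ x → x ≢ z)
mainTheorem14 G β z ψ _ tip critical 3<n =
  three-distinct-avoiding 3<n z , connected , connected-without
  where
  connected-without : ∀ w → w ≢ z → ConnectedOn G (λ x → x ≢ z × x ≢ w)
  connected-without = critical⇒connected-without tip critical
  connected : ConnectedOn G (λ x → x ≢ z)
  connected u v u≢z v≢z =
    let w , w≢z , w≢u , w≢v = fresh-vertex 3<n z u v
    in  Reach-mono proj₁ (connected-without w w≢z u v (u≢z , w≢u ∘ sym) (v≢z , w≢v ∘ sym))
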